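{- Let $G$ be a finite simple graph and $G_1,\dots,G_k$ its connected components. Then $\alpha^*(G)\geq\sum_{i=1}^k\alpha^*(G_i)$. In particular, if $G$ has $k$ components, then $\alpha^*(G)\ge k$.
   Context: An independent set $I$ of a graph $H$ means a nonempty set of pairwise non-adjacent vertices; $w_H(I)=\sum_{u\in I}d_H(u)$; $I$ is light if $w_H(I)\le |V(H)|-1$. $\alpha^*(H)=\max\{|I|: I\text{ a light independent set of }H\}$ (always at least 1 for nonempty $H$). -}

module Defs where

open import Data.Nat using (ℕ; _≤_; _∸_; _+_)
open import Data.Bool using (Bool; true; false; _∧_; if_then_else_)
open import Data.Fin using (Fin; _≟_)
open import Data.Fin.Subset using (Subset; _∈_; _⊆_; ∣_∣; Nonempty; ⊤)
open import Data.Vec using (Vec; tabulate; lookup; sum)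
open import Data.Product using (Σ; ∃; _×_)
open import Relation.Nullary.Decidable using (does)
open import Relation.Binary.PropositionalEquality using (_≡_)
open import Relation.Binary.Construct.Closure.ReflexiveTransitive using (Star)

record Graph (n : ℕ) : Set where
  field
    adj    : Fin n → Fin n → Bool
    sym    : ∀ u v → adj u v ≡ adj v u
    irrefl : ∀ v → adj v v ≡ false
open Graph public

module _ {n : ℕ} (G : Graph n) where

  Adjacent : Fin n → Fin n → Set
  Adjacent u v = adj G u v ≡ true

  Connected : Fin n → Fin n → Set
  Connected = Star Adjacent

  -- All notions below are relative to the induced subgraph H = G[S].
  -- degree of u in G[S]
  deg : Subset n → Fin n → ℕ
  deg S u = ∣ tabulate (λ v → lookup S v ∧ adj G u v) ∣

  weight : Subset n → Subset n → ℕ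
  weight S I = sum (tabulate (λ u → if lookup I u then deg S u else 0))

  IsIndependent : Subset n → Subset n → Set
  IsIndependent S I =
    I ⊆ S × Nonempty I × (∀ u v → u ∈ I → v ∈ I → adj G u v ≡ false)

  IsLightIndependent : Subset n → Subset n → Set
  IsLightIndependent S I = IsIndependent S I × weight S I ≤ ∣ S ∣ ∸ 1

  IsAlphaStarOn : Subset n → ℕ → Set
  IsAlphaStarOn S a =
    (∃ λ I → IsLightIndependent S I × ∣ I ∣ ≡ a)
    × (∀ I → IsLightIndependent S I → ∣ I ∣ ≤ a)

  IsAlphaStar : ℕ → Set
  IsAlphaStar = IsAlphaStarOn ⊤

component : ∀ {n k} → (Fin n → Fin k) → Fin k → Subset n
component c i = tabulate (λ v → does (c v ≟ i))

-- Take a maximum light independent set I_i in every component G_i and let J be their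
-- union. No edge joins two components, so J is independent and each vertex has the same
-- degree in G as in its component; hence
--   w_G(J) = Σ w_{G_i}(I_i) ≤ Σ (|G_i| - 1) = n - k ≤ n - 1,
-- so J is light and α*(G) ≥ |J| = Σ α*(G_i) ≥ k, as each I_i is nonempty.
{-# OPTIONS --safe #-}
module Submission where

open import Defs hiding (sym)
open import Data.Bool using (true; false; _∧_; if_then_else_)
open import Data.Bool.Properties using (∧-zeroʳ)
open import Data.Fin using (Fin; zero; suc; _≟_; punchIn)
open import Data.Fin.Properties using (punchInᵢ≢i; toℕ<n)
open import Data.Fin.Subset using (Subset; _∈_; _⊆_; ∣_∣; Nonempty; ⊤)
open import Data.Fin.Subset.Properties using (∈⊤; ∣⊤∣≡n; ⊆-antisym; x∈p⇒∣p-x∣<∣p∣)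
open import Data.Nat using (ℕ; zero; suc; _+_; _∸_; _≤_; z≤n; s≤s; >-nonZero)
open import Data.Nat.Properties
  using (+-0-commutativeMonoid; +-identityʳ; +-assoc; +-suc; suc-pred; m+n∸n≡m; m≤n+m;
         ≤-trans; ≤-reflexive; +-mono-≤; ∸-monoʳ-≤; module ≤-Reasoning)
open import Algebra.Properties.CommutativeMonoid.Sum +-0-commutativeMonoid
  using (sum-syntax; ∑-comm; sum-remove; sum-cong-≗; sum-replicate-zero)
  renaming (sum to ∑)
open import Data.Empty using (⊥-elim)
open import Data.Product using (∃; _×_; _,_; proj₁; proj₂)
open import Data.Vec using ([]; _∷_; tabulate; sum; lookup)
open import Data.Vec.Properties using (lookup∘tabulate; tabulate-cong; []=⇒lookup; lookup⇒[]=; lookup-replicate)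
open import Function using (_∘_; _⇔_; Equivalence)
open import Relation.Nullary.Decidable using (does; yes; no; dec-true)
open import Relation.Binary.PropositionalEquality
  using (_≡_; _≢_; refl; sym; trans; cong; subst; module ≡-Reasoning)
open import Relation.Binary.Construct.Closure.ReflexiveTransitive using (ε; _◅_)

sum-tabulate : ∀ {n} (f : Fin n → ℕ) → sum (tabulate f) ≡ ∑ f
sum-tabulate {zero}  f = refl
sum-tabulate {suc n} f = cong (f zero +_) (sum-tabulate (f ∘ suc))

∑-mono-≤ : ∀ {n} {f g : Fin n → ℕ} → (∀ i → f i ≤ g i) → ∑ f ≤ ∑ g
∑-mono-≤ {zero}  f≤g = z≤n
∑-mono-≤ {suc n} f≤g = +-mono-≤ (f≤g zero) (∑-mono-≤ (f≤g ∘ suc))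

∑-supportedAt : ∀ {n} (j : Fin n) (f : Fin n → ℕ) → (∀ i → i ≢ j → f i ≡ 0) → ∑ f ≡ f j
∑-supportedAt {suc n} j f f≡0 = begin
  ∑ f                              ≡⟨ sum-remove {i = j} f ⟩
  f j + ∑ (f ∘ punchIn j)          ≡⟨ cong (f j +_) (sum-cong-≗ (λ i → f≡0 _ (punchInᵢ≢i j i))) ⟩
  f j + ∑[ i < n ] 0               ≡⟨ cong (f j +_) (sum-replicate-zero n) ⟩
  f j + 0                          ≡⟨ +-identityʳ (f j) ⟩
  f j                              ∎
  where open ≡-Reasoning

∑-partition : ∀ {k n} (c : Fin n → Fin k) (g : Fin k → Fin n → ℕ) →
              (∀ i u → c u ≢ i → g i u ≡ 0) →
              ∑[ i < k ] ∑[ u < n ] g i u ≡ ∑[ u < n ] g (c u) u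
∑-partition c g g≡0 = trans (∑-comm g) (sum-cong-≗ λ u →
  ∑-supportedAt (c u) (λ i → g i u) (λ i i≢cu → g≡0 i u (i≢cu ∘ sym)))

∑[x∸1]+n≡∑x : ∀ {n} (x : Fin n → ℕ) → (∀ i → 1 ≤ x i) → ∑[ i < n ] (x i ∸ 1) + n ≡ ∑ x
∑[x∸1]+n≡∑x {zero}  x 1≤x = refl
∑[x∸1]+n≡∑x {suc n} x 1≤x = begin
  x₀ ∸ 1 + ∑[ i < n ] (x′ i ∸ 1) + suc n    ≡⟨ +-assoc (x₀ ∸ 1) _ (suc n) ⟩
  x₀ ∸ 1 + (∑[ i < n ] (x′ i ∸ 1) + suc n)  ≡⟨ cong (x₀ ∸ 1 +_) (+-suc _ n) ⟩
  x₀ ∸ 1 + suc (∑[ i < n ] (x′ i ∸ 1) + n)  ≡⟨ cong (λ m → x₀ ∸ 1 + suc m) (∑[x∸1]+n≡∑x x′ (1≤x ∘ suc)) ⟩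
  x₀ ∸ 1 + suc (∑ x′)                       ≡⟨ +-suc (x₀ ∸ 1) (∑ x′) ⟩
  suc (x₀ ∸ 1) + ∑ x′                       ≡⟨ cong (_+ ∑ x′) (suc-pred x₀ {{>-nonZero (1≤x zero)}}) ⟩
  x₀ + ∑ x′                                 ∎
  where
  open ≡-Reasoning
  x₀ : ℕ
  x₀ = x zero
  x′ : Fin n → ℕ
  x′ = x ∘ suc

1≤x⇒n≤∑x : ∀ {n} (x : Fin n → ℕ) → (∀ i → 1 ≤ x i) → n ≤ ∑ x
1≤x⇒n≤∑x {n} x 1≤x = ≤-trans (m≤n+m n _) (≤-reflexive (∑[x∸1]+n≡∑x x 1≤x))

nonempty⇒1≤∣p∣ : ∀ {n} {p : Subset n} → Nonempty p → 1 ≤ ∣ p ∣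
nonempty⇒1≤∣p∣ (x , x∈p) = ≤-trans (s≤s z≤n) (x∈p⇒∣p-x∣<∣p∣ x∈p)

∑∈ : ∀ {n} → Subset n → (Fin n → ℕ) → ℕ
∑∈ {n} p f = ∑[ u < n ] (if lookup p u then f u else 0)

∣p∣≡∑∈1 : ∀ {n} (p : Subset n) → ∣ p ∣ ≡ ∑∈ p (λ _ → 1)
∣p∣≡∑∈1 []          = refl
∣p∣≡∑∈1 (true ∷ p)  = cong suc (∣p∣≡∑∈1 p)
∣p∣≡∑∈1 (false ∷ p) = ∣p∣≡∑∈1 p

∑∈-cong : ∀ {n} (p : Subset n) {f g : Fin n → ℕ} → (∀ u → f u ≡ g u) → ∑∈ p f ≡ ∑∈ p g
∑∈-cong p f≡g = sum-cong-≗ (λ u → cong (λ m → if lookup p u then m else 0) (f≡g u))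

module _ {n k : ℕ} (c : Fin n → Fin k) where

  ∈-component⁺ : ∀ {u i} → c u ≡ i → u ∈ component c i
  ∈-component⁺ {u} {i} cu≡i =
    lookup⇒[]= u (component c i) (trans (lookup∘tabulate _ u) (dec-true (c u ≟ i) cu≡i))

  ∈-component⁻ : ∀ {u i} → u ∈ component c i → c u ≡ i
  ∈-component⁻ {u} {i} u∈ with c u ≟ i | lookup∘tabulate (λ v → does (c v ≟ i)) u
  ... | yes cu≡i | _         = cu≡i
  ... | no _     | lookup≡ff with () ← trans (sym lookup≡ff) ([]=⇒lookup u∈)

  -- When I i ⊆ component c i for all i, this is the union of the I i.
  glue : (Fin k → Subset n) → Subset n
  glue I = tabulate (λ u → lookup (I (c u)) u)

  module Glue (I : Fin k → Subset n) (I⊆C : ∀ i → I i ⊆ component c i) where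

    ∈-glue⁻ : ∀ {u} → u ∈ glue I → u ∈ I (c u)
    ∈-glue⁻ {u} u∈ = lookup⇒[]= u (I (c u)) (trans (sym (lookup∘tabulate _ u)) ([]=⇒lookup u∈))

    ∈-glue⁺ : ∀ {u i} → u ∈ I i → u ∈ glue I
    ∈-glue⁺ {u} {i} u∈ with refl ← ∈-component⁻ (I⊆C i u∈) =
      lookup⇒[]= u (glue I) (trans (lookup∘tabulate _ u) ([]=⇒lookup u∈))

    lookup-outside : ∀ {u i} → c u ≢ i → lookup (I i) u ≡ false
    lookup-outside {u} {i} cu≢i with lookup (I i) u in eq
    ... | true  = ⊥-elim (cu≢i (∈-component⁻ (I⊆C i (lookup⇒[]= u (I i) eq))))
    ... | false = refl

    ∑∈-glue : (h : Fin k → Fin n → ℕ) → ∑∈ (glue I) (λ u → h (c u) u) ≡ ∑[ i < k ] ∑∈ (I i) (h i)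
    ∑∈-glue h = begin
      ∑∈ (glue I) (λ u → h (c u) u)     ≡⟨ sum-cong-≗ (λ u → cong (λ b → if b then h (c u) u else 0) (lookup∘tabulate _ u)) ⟩
      ∑[ u < n ] g (c u) u              ≡⟨ ∑-partition c g g-outside ⟨
      ∑[ i < k ] ∑∈ (I i) (h i)         ∎
      where
      open ≡-Reasoning
      g : Fin k → Fin n → ℕ
      g i u = if lookup (I i) u then h i u else 0
      g-outside : ∀ i u → c u ≢ i → g i u ≡ 0
      g-outside i u cu≢i = cong (λ b → if b then h i u else 0) (lookup-outside cu≢i)

    ∣glue∣ : ∣ glue I ∣ ≡ ∑[ i < k ] ∣ I i ∣
    ∣glue∣ = trans (∣p∣≡∑∈1 (glue I))
                   (trans (∑∈-glue (λ _ _ → 1)) (sym (sum-cong-≗ (∣p∣≡∑∈1 ∘ I))))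

  open Glue public

  glue-components : glue (component c) ≡ ⊤
  glue-components =
    ⊆-antisym (λ _ → ∈⊤) (λ _ → ∈-glue⁺ (component c) (λ _ u∈ → u∈) (∈-component⁺ refl))

  ∑∣component∣≡n : ∑[ i < k ] ∣ component c i ∣ ≡ n
  ∑∣component∣≡n = begin
    ∑[ i < k ] ∣ component c i ∣  ≡⟨ ∣glue∣ (component c) (λ _ u∈ → u∈) ⟨
    ∣ glue (component c) ∣        ≡⟨ cong ∣_∣ glue-components ⟩
    ∣ ⊤ {n} ∣                     ≡⟨ ∣⊤∣≡n n ⟩
    n                             ∎
    where open ≡-Reasoning

  ∑[∣component∣∸1]≡n∸k : (∀ i → Nonempty (component c i)) →
                         ∑[ i < k ] (∣ component c i ∣ ∸ 1) ≡ n ∸ k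
  ∑[∣component∣∸1]≡n∸k nonempty = begin
    ∑[ i < k ] (∣ component c i ∣ ∸ 1)          ≡⟨ m+n∸n≡m _ k ⟨
    ∑[ i < k ] (∣ component c i ∣ ∸ 1) + k ∸ k  ≡⟨ cong (_∸ k) (∑[x∸1]+n≡∑x _ (nonempty⇒1≤∣p∣ ∘ nonempty)) ⟩
    ∑[ i < k ] ∣ component c i ∣ ∸ k            ≡⟨ cong (_∸ k) ∑∣component∣≡n ⟩
    n ∸ k                                       ∎
    where open ≡-Reasoning

RespectsAdjacency : ∀ {n k} → Graph n → (Fin n → Fin k) → Set
RespectsAdjacency G c = ∀ {u v} → Adjacent G u v → c u ≡ c v

nbrs⊆S⇒deg≡deg⊤ : ∀ {n} (G : Graph n) {S u} → (∀ {v} → Adjacent G u v → v ∈ S) → deg G S u ≡ deg G ⊤ u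
nbrs⊆S⇒deg≡deg⊤ G {S} {u} nbrs⊆S = cong ∣_∣ (tabulate-cong agree)
  where
  agree : ∀ v → (lookup S v ∧ adj G u v) ≡ (lookup ⊤ v ∧ adj G u v)
  agree v with adj G u v in uv
  ... | false = trans (∧-zeroʳ _) (sym (∧-zeroʳ _))
  ... | true  = cong (_∧ true) (trans ([]=⇒lookup (nbrs⊆S uv)) (sym (lookup-replicate v true)))

weight≡∑∈deg : ∀ {n} (G : Graph n) (S I : Subset n) → weight G S I ≡ ∑∈ I (deg G S)
weight≡∑∈deg G S I = sum-tabulate (λ u → if lookup I u then deg G S u else 0)

module _ {n k} (G : Graph n) {c : Fin n → Fin k} (c-resp : RespectsAdjacency G c) {I : Fin k → Subset n} where

  weight-glue : (∀ i → I i ⊆ component c i) →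
                weight G ⊤ (glue c I) ≡ ∑[ i < k ] weight G (component c i) (I i)
  weight-glue I⊆C = begin
    weight G ⊤ (glue c I)                                ≡⟨ weight≡∑∈deg G ⊤ (glue c I) ⟩
    ∑∈ (glue c I) (deg G ⊤)                              ≡⟨ ∑∈-cong (glue c I) deg⊤≡deg[component] ⟩
    ∑∈ (glue c I) (λ u → deg G (component c (c u)) u)    ≡⟨ ∑∈-glue c I I⊆C (λ i → deg G (component c i)) ⟩
    ∑[ i < k ] ∑∈ (I i) (deg G (component c i))          ≡⟨ sum-cong-≗ (λ i → weight≡∑∈deg G (component c i) (I i)) ⟨
    ∑[ i < k ] weight G (component c i) (I i)            ∎
    where
    open ≡-Reasoning
    deg⊤≡deg[component] : ∀ u → deg G ⊤ u ≡ deg G (component c (c u)) u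
    deg⊤≡deg[component] u = sym (nbrs⊆S⇒deg≡deg⊤ G (λ uv → ∈-component⁺ c (sym (c-resp uv))))

  glue-independent : (∀ i → IsIndependent G (component c i) (I i)) → Fin k →
                     IsIndependent G ⊤ (glue c I)
  glue-independent indep i₀ = (λ _ → ∈⊤) , nonempty , no-edge
    where
    I⊆C : ∀ i → I i ⊆ component c i
    I⊆C i = proj₁ (indep i)
    nonempty : Nonempty (glue c I)
    nonempty with (u , u∈) ← proj₁ (proj₂ (indep i₀)) = u , ∈-glue⁺ c I I⊆C u∈
    no-edge : ∀ u v → u ∈ glue c I → v ∈ glue c I → adj G u v ≡ false
    no-edge u v u∈ v∈ with adj G u v in uv
    ... | false = refl
    ... | true  = trans (sym uv) (proj₂ (proj₂ (indep (c u))) u v (∈-glue⁻ c I I⊆C u∈)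
                    (subst (λ j → v ∈ I j) (sym (c-resp uv)) (∈-glue⁻ c I I⊆C v∈)))

  glue-isLightIndependent : (∀ i → IsLightIndependent G (component c i) (I i)) → Fin k →
                            IsLightIndependent G ⊤ (glue c I)
  glue-isLightIndependent light i₀ = glue-independent (proj₁ ∘ light) i₀ , light-weight
    where
    I⊆C : ∀ i → I i ⊆ component c i
    I⊆C i = proj₁ (proj₁ (light i))
    component-nonempty : ∀ i → Nonempty (component c i)
    component-nonempty i with (u , u∈) ← proj₁ (proj₂ (proj₁ (light i))) = u , I⊆C i u∈
    light-weight : weight G ⊤ (glue c I) ≤ ∣ ⊤ {n} ∣ ∸ 1
    light-weight = begin
      weight G ⊤ (glue c I)                      ≡⟨ weight-glue I⊆C ⟩
      ∑[ i < k ] weight G (component c i) (I i)  ≤⟨ ∑-mono-≤ (proj₂ ∘ light) ⟩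
      ∑[ i < k ] (∣ component c i ∣ ∸ 1)         ≡⟨ ∑[∣component∣∸1]≡n∸k c component-nonempty ⟩
      n ∸ k                                      ≤⟨ ∸-monoʳ-≤ n (≤-trans (s≤s z≤n) (toℕ<n i₀)) ⟩
      n ∸ 1                                      ≡⟨ cong (_∸ 1) (∣⊤∣≡n n) ⟨
      ∣ ⊤ {n} ∣ ∸ 1                              ∎
      where open ≤-Reasoning

-- c need not be surjective: each component contains the nonempty set I i anyway.
lemma2 : ∀ {n} (G : Graph n) (k : ℕ) (c : Fin n → Fin k)
         → (∀ i → ∃ λ v → c v ≡ i)
         → (∀ u v → (c u ≡ c v) ⇔ Connected G u v)
         → (a : ℕ) → IsAlphaStar G a
         → (as : Fin k → ℕ) → (∀ i → IsAlphaStarOn G (component c i) (as i))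
         → sum (tabulate as) ≤ a × k ≤ a
lemma2 G k c _ c≡⇔Connected a ((_ , ((_ , (v , _) , _) , _) , _) , maximal) as α*[component] =
  ∑as≤a , ≤-trans k≤∑as ∑as≤a
  where
  I : Fin k → Subset _
  I i = proj₁ (proj₁ (α*[component] i))
  light : ∀ i → IsLightIndependent G (component c i) (I i)
  light i = proj₁ (proj₂ (proj₁ (α*[component] i)))
  ∣I∣≡as : ∀ i → ∣ I i ∣ ≡ as i
  ∣I∣≡as i = proj₂ (proj₂ (proj₁ (α*[component] i)))

  c-resp : RespectsAdjacency G c
  c-resp uv = Equivalence.from (c≡⇔Connected _ _) (uv ◅ ε)

  ∣glue∣≡∑as : ∣ glue c I ∣ ≡ sum (tabulate as)
  ∣glue∣≡∑as = trans (∣glue∣ c I (proj₁ ∘ proj₁ ∘ light))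
                     (trans (sum-cong-≗ ∣I∣≡as) (sym (sum-tabulate as)))

  ∑as≤a : sum (tabulate as) ≤ a
  ∑as≤a = subst (_≤ a) ∣glue∣≡∑as (maximal (glue c I) (glue-isLightIndependent G c-resp light (c v)))

  k≤∑as : k ≤ sum (tabulate as)
  k≤∑as = subst (k ≤_) (sym (sum-tabulate as)) (1≤x⇒n≤∑x as λ i →
    subst (1 ≤_) (∣I∣≡as i) (nonempty⇒1≤∣p∣ (proj₁ (proj₂ (proj₁ (light i))))))
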